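{- Let $\varphi$ be an untangled first-order formula of mt-logic and $X$ a team with $\mathrm{FV}(\varphi)\subseteq\mathrm{dom}(X)$ and $\mathrm{dom}(X)\cap\mathrm{BV}(\varphi)=\emptyset$. Then $\mathcal M,X\models\varphi$ iff $X=[\![\varphi]\!]^{\mathcal M}_{\mathrm{dom}(X)}$.
   Context: $\mathcal M$ is a structure with universe $M$. Assignments are functions $s:V\to M$ ($V$ finite set of variables); $s[a/x]$ modifies/extends $s$ to send $x$ to $a$. A team $X$ is a finite set $\mathrm{dom}(X)$ of variables with a set (also denoted $X$) of assignments with domain $\mathrm{dom}(X)$ (one empty team per domain). $\exists xX=\{s:\mathrm{dom}(X)\setminus\{x\}\to M\mid s[a/x]\in X\text{ for some }a,\text{ or }s\in X\}$, $\forall xX=\{s:\mathrm{dom}(X)\setminus\{x\}\to M\mid s[a/x]\in X\text{ for all }a\in M,\text{ or }s\in X\}$, both with domain $\mathrm{dom}(X)\setminus\{x\}$. mt-logic formulas: literals, $\varphi\wedge^{\mathrm{in}}\psi$, $\varphi\vee^{\mathrm{in}}\psi$ (internal), $\varphi\wedge\psi$, $\varphi\vee\psi$ (external), $\exists x\varphi$, $\forall x\varphi$. Satisfaction for $\mathrm{FV}(\varphi)\subseteq\mathrm{dom}(X)$: literal $\psi$: for every $s:\mathrm{dom}(X)\to M$, $s\in X$ iff $\mathcal M,s\models\psi$; $\varphi\wedge^{\mathrm{in}}\psi$: $X=Y\cap Z$ for some $Y\models\varphi$, $Z\models\psi$; $\varphi\vee^{\mathrm{in}}\psi$: $X=Y\cup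 Z$ for some $Y\models\varphi$, $Z\models\psi$; $\wedge$: both; $\vee$: at least one; $\exists x\varphi$: some $Y$ with $x\in\mathrm{dom}(Y)$, $\exists xY=\exists xX$, $Y\models\varphi$; $\forall x\varphi$: some $Y$ with $x\in\mathrm{dom}(Y)$, $\forall xY=\exists xX$, $Y\models\varphi$. A formula is first-order if it contains no external $\wedge$ or $\vee$; for such $\varphi$ (reading internal connectives as ordinary ones) with $\mathrm{FV}(\varphi)\subseteq V$, $[\![\varphi]\!]^{\mathcal M}_V=\{s:V\to M\mid\mathcal M,s\models\varphi\}$ (Tarskian), a team with domain $V$. $\mathrm{BV}(\varphi)$ is the set of bound variables. A formula is untangled if no quantifier binding $x$ occurs in the scope of another quantifier binding the same $x$, and no variable is both free and bound. -}

module Defs where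

open import Level using (Lift; lift) renaming (suc to lsuc; zero to lzero)
open import Data.Nat using (ℕ; _≟_; _≡ᵇ_)
open import Data.Bool using (Bool; if_then_else_)
open import Data.Maybe using (Maybe; just; nothing)
open import Data.Vec using (Vec; []; _∷_)
open import Data.List using (List; filter)
open import Data.List.Membership.Propositional using (_∈_; _∉_)
open import Data.Product using (Σ; Σ-syntax; ∃; ∃-syntax; _×_; _,_; proj₁; proj₂)
open import Data.Sum using (_⊎_; inj₁; inj₂)
open import Data.Empty using (⊥)
open import Data.Unit using (⊤)
open import Relation.Nullary using (¬_; ¬?)
open import Relation.Binary.PropositionalEquality
  using (_≡_; _≢_; refl; sym; trans; cong; subst)
open import Function.Bundles using (_⇔_; mk⇔)

record Signature : Set₁ where
  field
    FunSym   : Set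
    funArity : FunSym → ℕ
    RelSym   : Set
    relArity : RelSym → ℕ

record Structure (L : Signature) : Set₁ where
  open Signature L
  field
    Carrier : Set
    funI    : (f : FunSym) → Vec Carrier (funArity f) → Carrier
    relI    : (R : RelSym) → Vec Carrier (relArity R) → Set

module Syntax (L : Signature) where
  open Signature L

  data Term : Set where
    var : ℕ → Term
    app : (f : FunSym) → Vec Term (funArity f) → Term

  data Literal : Set where
    rel  : (R : RelSym) → Vec Term (relArity R) → Literal
    nrel : (R : RelSym) → Vec Term (relArity R) → Literal
    eq   : Term → Term → Literal
    neq  : Term → Term → Literal

  infixr 6 _∧ⁱ_ _∧ᵉ_
  infixr 5 _∨ⁱ_ _∨ᵉ_
  data Formula : Set where
    lit   : Literal → Formula
    _∧ⁱ_  : Formula → Formula → Formula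
    _∨ⁱ_  : Formula → Formula → Formula
    _∧ᵉ_  : Formula → Formula → Formula
    _∨ᵉ_  : Formula → Formula → Formula
    ex    : ℕ → Formula → Formula
    all   : ℕ → Formula → Formula

  mutual
    FreeT : ℕ → Term → Set
    FreeT z (var y)    = z ≡ y
    FreeT z (app f ts) = FreeTs z ts

    FreeTs : ∀ {n} → ℕ → Vec Term n → Set
    FreeTs z []       = ⊥
    FreeTs z (t ∷ ts) = FreeT z t ⊎ FreeTs z ts

  FreeL : ℕ → Literal → Set
  FreeL z (rel R ts)  = FreeTs z ts
  FreeL z (nrel R ts) = FreeTs z ts
  FreeL z (eq t u)    = FreeT z t ⊎ FreeT z u
  FreeL z (neq t u)   = FreeT z t ⊎ FreeT z u

  Free : ℕ → Formula → Set
  Free z (lit l)  = FreeL z l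
  Free z (φ ∧ⁱ ψ) = Free z φ ⊎ Free z ψ
  Free z (φ ∨ⁱ ψ) = Free z φ ⊎ Free z ψ
  Free z (φ ∧ᵉ ψ) = Free z φ ⊎ Free z ψ
  Free z (φ ∨ᵉ ψ) = Free z φ ⊎ Free z ψ
  Free z (ex x φ)  = z ≢ x × Free z φ
  Free z (all x φ) = z ≢ x × Free z φ

  Bound : ℕ → Formula → Set
  Bound z (lit l)  = ⊥
  Bound z (φ ∧ⁱ ψ) = Bound z φ ⊎ Bound z ψ
  Bound z (φ ∨ⁱ ψ) = Bound z φ ⊎ Bound z ψ
  Bound z (φ ∧ᵉ ψ) = Bound z φ ⊎ Bound z ψ
  Bound z (φ ∨ᵉ ψ) = Bound z φ ⊎ Bound z ψ
  Bound z (ex x φ)  = z ≡ x ⊎ Bound z φ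
  Bound z (all x φ) = z ≡ x ⊎ Bound z φ

  FirstOrder : Formula → Set
  FirstOrder (lit l)   = ⊤
  FirstOrder (φ ∧ⁱ ψ)  = FirstOrder φ × FirstOrder ψ
  FirstOrder (φ ∨ⁱ ψ)  = FirstOrder φ × FirstOrder ψ
  FirstOrder (φ ∧ᵉ ψ)  = ⊥
  FirstOrder (φ ∨ᵉ ψ)  = ⊥
  FirstOrder (ex x φ)  = FirstOrder φ
  FirstOrder (all x φ) = FirstOrder φ

  NoRebinding : Formula → Set
  NoRebinding (lit l)   = ⊤
  NoRebinding (φ ∧ⁱ ψ)  = NoRebinding φ × NoRebinding ψ
  NoRebinding (φ ∨ⁱ ψ)  = NoRebinding φ × NoRebinding ψ
  NoRebinding (φ ∧ᵉ ψ)  = NoRebinding φ × NoRebinding ψ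
  NoRebinding (φ ∨ᵉ ψ)  = NoRebinding φ × NoRebinding ψ
  NoRebinding (ex x φ)  = ¬ Bound x φ × NoRebinding φ
  NoRebinding (all x φ) = ¬ Bound x φ × NoRebinding φ

  Untangled : Formula → Set
  Untangled φ = NoRebinding φ × (∀ z → Free z φ → ¬ Bound z φ)

module Semantics {L : Signature} (𝓜 : Structure L) where
  open Signature L
  open Structure 𝓜 renaming (Carrier to M)
  open Syntax L

  -- An assignment with domain V is represented as a partial map
  -- s : ℕ → Maybe M whose set of defined points is exactly V.
  PAsg : Set
  PAsg = ℕ → Maybe M

  Dom : Set
  Dom = List ℕ     -- a finite set of variables

  HasDom : PAsg → Dom → Set
  HasDom s V = ∀ z → (z ∈ V → ∃[ a ] s z ≡ just a) × (z ∉ V → s z ≡ nothing)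

  _≗ₐ_ : PAsg → PAsg → Set
  s ≗ₐ t = ∀ z → s z ≡ t z

  _[_/_] : PAsg → M → ℕ → PAsg
  (s [ a / x ]) y = if y ≡ᵇ x then just a else s y

  removeVar : ℕ → Dom → Dom
  removeVar x V = filter (λ y → ¬? (y ≟ x)) V

  record Team : Set₁ where
    field
      dom  : Dom
      mem  : PAsg → Set
      wf   : ∀ s → mem s → HasDom s dom
      resp : ∀ s t → s ≗ₐ t → mem s → mem t   -- it is a set of functions
  open Team public

  SameDom : Dom → Dom → Set
  SameDom V W = ∀ z → (z ∈ V ⇔ z ∈ W)

  _≐_ : Team → Team → Set
  X ≐ Y = SameDom (dom X) (dom Y) × (∀ s → mem X s ⇔ mem Y s)

  private
    upd-resp : ∀ {s t} a x → s ≗ₐ t → (s [ a / x ]) ≗ₐ (t [ a / x ])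
    upd-resp {s} {t} a x e y with y ≡ᵇ x
    ... | Bool.true  = refl
    ... | Bool.false = e y

    hasDom-resp : ∀ {s t} V → s ≗ₐ t → HasDom s V → HasDom t V
    hasDom-resp V e h z =
      (λ z∈ → let (a , p) = proj₁ (h z) z∈ in a , trans (sym (e z)) p) ,
      (λ z∉ → trans (sym (e z)) (proj₂ (h z) z∉))

  ∃T : ℕ → Team → Team
  ∃T x X = record
    { dom  = removeVar x (dom X)
    ; mem  = λ s → HasDom s (removeVar x (dom X))
                   × ((Σ[ a ∈ M ] mem X (s [ a / x ])) ⊎ mem X s)
    ; wf   = λ s m → proj₁ m
    ; resp = λ s t e m → hasDom-resp (removeVar x (dom X)) e (proj₁ m) , rsp s t e (proj₂ m)
    }
    where
    rsp : ∀ s t → s ≗ₐ t → (Σ[ a ∈ M ] mem X (s [ a / x ])) ⊎ mem X s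
                         → (Σ[ a ∈ M ] mem X (t [ a / x ])) ⊎ mem X t
    rsp s t e (inj₁ (a , m)) = inj₁ (a , resp X _ _ (upd-resp a x e) m)
    rsp s t e (inj₂ m)       = inj₂ (resp X s t e m)

  ∀T : ℕ → Team → Team
  ∀T x X = record
    { dom  = removeVar x (dom X)
    ; mem  = λ s → HasDom s (removeVar x (dom X))
                   × ((∀ (a : M) → mem X (s [ a / x ])) ⊎ mem X s)
    ; wf   = λ s m → proj₁ m
    ; resp = λ s t e m → hasDom-resp (removeVar x (dom X)) e (proj₁ m) , rsp s t e (proj₂ m)
    }
    where
    rsp : ∀ s t → s ≗ₐ t → (∀ (a : M) → mem X (s [ a / x ])) ⊎ mem X s
                         → (∀ (a : M) → mem X (t [ a / x ])) ⊎ mem X t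
    rsp s t e (inj₁ f) = inj₁ (λ a → resp X _ _ (upd-resp a x e) (f a))
    rsp s t e (inj₂ m) = inj₂ (resp X s t e m)

  mutual
    evalT : PAsg → Term → Maybe M
    evalT s (var y)    = s y
    evalT s (app f ts) with evalTs s ts
    ... | just v  = just (funI f v)
    ... | nothing = nothing

    evalTs : ∀ {n} → PAsg → Vec Term n → Maybe (Vec M n)
    evalTs s []       = just []
    evalTs s (t ∷ ts) with evalT s t | evalTs s ts
    ... | just a  | just v = just (a ∷ v)
    ... | _       | _      = nothing

  OnJust : {A : Set} → Maybe A → (A → Set) → Set
  OnJust nothing  P = ⊥
  OnJust (just a) P = P a

  OnJust₂ : {A : Set} → Maybe A → Maybe A → (A → A → Set) → Set
  OnJust₂ m n P = OnJust m (λ a → OnJust n (λ b → P a b))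

  litSat : PAsg → Literal → Set
  litSat s (rel R ts)  = OnJust (evalTs s ts) (relI R)
  litSat s (nrel R ts) = OnJust (evalTs s ts) (λ v → ¬ relI R v)
  litSat s (eq t u)    = OnJust₂ (evalT s t) (evalT s u) _≡_
  litSat s (neq t u)   = OnJust₂ (evalT s t) (evalT s u) _≢_

  -- Tarskian satisfaction (external connectives read as ordinary ones;
  -- only used for first-order formulas)
  tsat : PAsg → Formula → Set
  tsat s (lit l)   = litSat s l
  tsat s (φ ∧ⁱ ψ)  = tsat s φ × tsat s ψ
  tsat s (φ ∨ⁱ ψ)  = tsat s φ ⊎ tsat s ψ
  tsat s (φ ∧ᵉ ψ)  = tsat s φ × tsat s ψ
  tsat s (φ ∨ᵉ ψ)  = tsat s φ ⊎ tsat s ψ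
  tsat s (ex x φ)  = Σ[ a ∈ M ] tsat (s [ a / x ]) φ
  tsat s (all x φ) = ∀ (a : M) → tsat (s [ a / x ]) φ

  private
    mutual
      evalT-resp : ∀ {s t} → s ≗ₐ t → ∀ u → evalT s u ≡ evalT t u
      evalT-resp e (var y) = e y
      evalT-resp {s} {t} e (app f ts)
        rewrite evalTs-resp {s} {t} e ts = refl

      evalTs-resp : ∀ {s t} → s ≗ₐ t → ∀ {n} (ts : Vec Term n) → evalTs s ts ≡ evalTs t ts
      evalTs-resp e [] = refl
      evalTs-resp {s} {t} e (u ∷ ts)
        rewrite evalT-resp {s} {t} e u | evalTs-resp {s} {t} e ts = refl

    litSat-resp : ∀ {s t} → s ≗ₐ t → ∀ l → litSat s l → litSat t l
    litSat-resp {s} {t} e (rel R ts) p rewrite evalTs-resp {s} {t} e ts = p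
    litSat-resp {s} {t} e (nrel R ts) p rewrite evalTs-resp {s} {t} e ts = p
    litSat-resp {s} {t} e (eq u w) p rewrite evalT-resp {s} {t} e u | evalT-resp {s} {t} e w = p
    litSat-resp {s} {t} e (neq u w) p rewrite evalT-resp {s} {t} e u | evalT-resp {s} {t} e w = p

    tsat-resp : ∀ {s t} → s ≗ₐ t → ∀ φ → tsat s φ → tsat t φ
    tsat-resp e (lit l) p = litSat-resp e l p
    tsat-resp e (φ ∧ⁱ ψ) (p , q) = tsat-resp e φ p , tsat-resp e ψ q
    tsat-resp e (φ ∨ⁱ ψ) (inj₁ p) = inj₁ (tsat-resp e φ p)
    tsat-resp e (φ ∨ⁱ ψ) (inj₂ q) = inj₂ (tsat-resp e ψ q)
    tsat-resp e (φ ∧ᵉ ψ) (p , q) = tsat-resp e φ p , tsat-resp e ψ q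
    tsat-resp e (φ ∨ᵉ ψ) (inj₁ p) = inj₁ (tsat-resp e φ p)
    tsat-resp e (φ ∨ᵉ ψ) (inj₂ q) = inj₂ (tsat-resp e ψ q)
    tsat-resp e (ex x φ) (a , p) = a , tsat-resp (upd-resp a x e) φ p
    tsat-resp e (all x φ) f = λ a → tsat-resp (upd-resp a x e) φ (f a)

  ⟦_⟧_ : Formula → Dom → Team
  ⟦ φ ⟧ V = record
    { dom  = V
    ; mem  = λ s → HasDom s V × tsat s φ
    ; wf   = λ s m → proj₁ m
    ; resp = λ s t e m → hasDom-resp V e (proj₁ m) , tsat-resp e φ (proj₂ m)
    }

  infix 4 _⊨_
  _⊨_ : Team → Formula → Set₁
  X ⊨ lit l = Lift (lsuc lzero)
    (∀ s → HasDom s (dom X) → (mem X s ⇔ litSat s l))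
  X ⊨ (φ ∧ⁱ ψ) = Σ[ Y ∈ Team ] Σ[ Z ∈ Team ]
    (Y ⊨ φ) × (Z ⊨ ψ) × Lift (lsuc lzero)
      (SameDom (dom Y) (dom X) × SameDom (dom Z) (dom X)
       × (∀ s → mem X s ⇔ (mem Y s × mem Z s)))
  X ⊨ (φ ∨ⁱ ψ) = Σ[ Y ∈ Team ] Σ[ Z ∈ Team ]
    (Y ⊨ φ) × (Z ⊨ ψ) × Lift (lsuc lzero)
      (SameDom (dom Y) (dom X) × SameDom (dom Z) (dom X)
       × (∀ s → mem X s ⇔ (mem Y s ⊎ mem Z s)))
  X ⊨ (φ ∧ᵉ ψ) = (X ⊨ φ) × (X ⊨ ψ)
  X ⊨ (φ ∨ᵉ ψ) = (X ⊨ φ) ⊎ (X ⊨ ψ)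
  X ⊨ ex x φ  = Σ[ Y ∈ Team ] Lift (lsuc lzero) (x ∈ dom Y × (∃T x Y ≐ ∃T x X)) × (Y ⊨ φ)
  X ⊨ all x φ = Σ[ Y ∈ Team ] Lift (lsuc lzero) (x ∈ dom Y × (∀T x Y ≐ ∃T x X)) × (Y ⊨ φ)

-- Induction on φ, for all teams over a fixed set V of variables disjoint from
-- the bound variables of φ.  The connective cases are pointwise set algebra.
-- For a quantifier on x we have x ∉ V, so ∃x X = X, and the domain of any
-- witness team Y must be V ∪ {x}; by induction Y = ⟦φ⟧, so ∃x Y and ∀x Y are
-- the Tarskian meanings of ∃x φ and ∀x φ.  Conversely ⟦φ⟧_(V ∪ {x}) is a witness.
module Submission where

open import Defs
open import Data.Product using (_×_)
open import Data.List.Membership.Propositional using (_∈_)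
open import Relation.Nullary using (¬_)
open import Function.Bundles using (_⇔_)

open import Level using (lift) renaming (suc to lsuc; zero to lzero)
open import Data.Nat using (_≟_; _≡ᵇ_)
open import Data.Nat.Properties using (≡ᵇ⇒≡; ≡⇒≡ᵇ)
open import Data.Bool using (true; false; T)
open import Data.Maybe using (just; nothing)
open import Data.List using (_∷_)
open import Data.List.Membership.Propositional using (_∉_)
open import Data.List.Membership.Propositional.Properties using (∈-filter⁺; ∈-filter⁻)
open import Data.List.Relation.Unary.Any using (here; there)
open import Data.Product using (_,_; proj₁; proj₂)
open import Data.Product.Function.NonDependent.Propositional using (_×-⇔_)
open import Data.Sum using (_⊎_; inj₁; inj₂)
open import Data.Sum.Function.Propositional using (_⊎-⇔_)
open import Data.Empty using (⊥-elim)
open import Data.Unit using (tt)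
open import Function using (_∘_)
open import Function.Bundles using (mk⇔; Equivalence)
open import Function.Properties.Equivalence
  using () renaming (refl to ⇔-refl; sym to ⇔-sym; trans to ⇔-trans)
open import Relation.Nullary using (¬?; yes; no)
open import Relation.Binary.Bundles using (Setoid)
open import Relation.Binary.PropositionalEquality using (_≡_; _≢_; refl; sym; trans; subst)

open Equivalence using (to; from)

module TarskianTeams {L : Signature} (𝓜 : Structure L) where
  open Syntax L
  open Semantics 𝓜

  update-≡ : ∀ (s : PAsg) a x → (s [ a / x ]) x ≡ just a
  update-≡ s a x with x ≡ᵇ x in eq
  ... | true  = refl
  ... | false = ⊥-elim (subst T eq (≡⇒≡ᵇ x x refl))

  update-≢ : ∀ (s : PAsg) a {x z} → z ≢ x → (s [ a / x ]) z ≡ s z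
  update-≢ s a {x} {z} z≢x with z ≡ᵇ x in eq
  ... | true  = ⊥-elim (z≢x (≡ᵇ⇒≡ z x (subst T (sym eq) tt)))
  ... | false = refl

  ∈-removeVar⁺ : ∀ {x z V} → z ∈ V → z ≢ x → z ∈ removeVar x V
  ∈-removeVar⁺ {x} = ∈-filter⁺ (λ y → ¬? (y ≟ x))

  ∈-removeVar⁻ : ∀ {x z V} → z ∈ removeVar x V → z ∈ V × z ≢ x
  ∈-removeVar⁻ {x} = ∈-filter⁻ (λ y → ¬? (y ≟ x))

  SameDom-refl : ∀ {V} → SameDom V V
  SameDom-refl z = ⇔-refl

  SameDom-sym : ∀ {V W} → SameDom V W → SameDom W V
  SameDom-sym sd z = ⇔-sym (sd z)

  SameDom-trans : ∀ {U V W} → SameDom U V → SameDom V W → SameDom U W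
  SameDom-trans sd sd′ z = ⇔-trans (sd z) (sd′ z)

  SameDom-∷ : ∀ {x V W} → SameDom V W → SameDom (x ∷ V) (x ∷ W)
  SameDom-∷ sd z = mk⇔ (move (to (sd z))) (move (from (sd z)))
    where
    move : ∀ {x V W} → (z ∈ V → z ∈ W) → z ∈ x ∷ V → z ∈ x ∷ W
    move f (here z≡x) = here z≡x
    move f (there z∈V) = there (f z∈V)

  removeVar-cong : ∀ {x V W} → SameDom V W → SameDom (removeVar x V) (removeVar x W)
  removeVar-cong sd z = mk⇔ (move (to (sd z))) (move (from (sd z)))
    where
    move : ∀ {x V W} → (z ∈ V → z ∈ W) → z ∈ removeVar x V → z ∈ removeVar x W
    move f z∈ = let z∈V , z≢x = ∈-removeVar⁻ z∈ in ∈-removeVar⁺ (f z∈V) z≢x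

  removeVar-fresh : ∀ {x V} → x ∉ V → SameDom (removeVar x V) V
  removeVar-fresh x∉V z = mk⇔ (proj₁ ∘ ∈-removeVar⁻)
    (λ z∈V → ∈-removeVar⁺ z∈V λ { refl → x∉V z∈V })

  removeVar-∷ : ∀ {x V} → x ∉ V → SameDom (removeVar x (x ∷ V)) V
  removeVar-∷ {x} {V} x∉V z =
    mk⇔ drop (λ z∈V → ∈-removeVar⁺ {x} {z} {x ∷ V} (there z∈V) λ { refl → x∉V z∈V })
    where
    drop : z ∈ removeVar x (x ∷ V) → z ∈ V
    drop z∈ with ∈-removeVar⁻ {x} {z} {x ∷ V} z∈
    ... | here z≡x , z≢x = ⊥-elim (z≢x z≡x)
    ... | there z∈V , _  = z∈V

  SameDom-∷-removeVar : ∀ {x V W} → x ∈ V → SameDom (removeVar x V) W → SameDom V (x ∷ W)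
  SameDom-∷-removeVar {x} {V} {W} x∈V sd z = mk⇔ add remove
    where
    add : z ∈ V → z ∈ x ∷ W
    add z∈V with z ≟ x
    ... | yes z≡x = here z≡x
    ... | no z≢x  = there (to (sd z) (∈-removeVar⁺ z∈V z≢x))
    remove : z ∈ x ∷ W → z ∈ V
    remove (here refl)  = x∈V
    remove (there z∈W) = proj₁ (∈-removeVar⁻ (from (sd z) z∈W))

  HasDom-cong : ∀ {s V W} → SameDom V W → HasDom s V → HasDom s W
  HasDom-cong sd h z = proj₁ (h z) ∘ from (sd z) , λ z∉W → proj₂ (h z) (z∉W ∘ to (sd z))

  ∉-removeVar : ∀ {x} V → x ∉ removeVar x V
  ∉-removeVar {x} V x∈ = proj₂ (∈-removeVar⁻ {x} {x} {V} x∈) refl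

  just≢nothing : ∀ {A : Set} {a : A} → just a ≢ nothing
  just≢nothing ()

  HasDom-defined : ∀ {s V x} → HasDom s V → x ∈ V → s x ≢ nothing
  HasDom-defined {x = x} h x∈V sx≡nothing =
    let a , sx≡a = proj₁ (h x) x∈V in just≢nothing (trans (sym sx≡a) sx≡nothing)

  ¬HasDom-update : ∀ {s x V} a → x ∉ V → ¬ HasDom (s [ a / x ]) V
  ¬HasDom-update {s} {x} a x∉V h = just≢nothing (trans (sym (update-≡ s a x)) (proj₂ (h x) x∉V))

  HasDom-update : ∀ {s x W} a → x ∈ W → HasDom s (removeVar x W) → HasDom (s [ a / x ]) W
  HasDom-update {s} {x} {W} a x∈W h z with z ≟ x
  ... | yes refl = (λ _ → a , update-≡ s a x) , (λ x∉W → ⊥-elim (x∉W x∈W))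
  ... | no z≢x =
    (λ z∈W → let b , sz≡b = proj₁ (h z) (∈-removeVar⁺ z∈W z≢x) in b , trans (update-≢ s a z≢x) sz≡b) ,
    (λ z∉W → trans (update-≢ s a z≢x) (proj₂ (h z) (z∉W ∘ proj₁ ∘ ∈-removeVar⁻)))

  ≐-refl : ∀ {X} → X ≐ X
  ≐-refl = SameDom-refl , λ s → ⇔-refl

  ≐-sym : ∀ {X Y} → X ≐ Y → Y ≐ X
  ≐-sym (sd , e) = SameDom-sym sd , λ s → ⇔-sym (e s)

  ≐-trans : ∀ {X Y Z} → X ≐ Y → Y ≐ Z → X ≐ Z
  ≐-trans (sd , e) (sd′ , e′) = SameDom-trans sd sd′ , λ s → ⇔-trans (e s) (e′ s)

  ≐-setoid : Setoid (lsuc lzero) lzero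
  ≐-setoid = record
    { Carrier = Team
    ; _≈_ = _≐_
    ; isEquivalence = record
      { refl  = λ {X} → ≐-refl {X}
      ; sym   = λ {X Y} → ≐-sym {X} {Y}
      ; trans = λ {X Y Z} → ≐-trans {X} {Y} {Z}
      }
    }

  open import Relation.Binary.Reasoning.Setoid ≐-setoid

  ⟦⟧-cong : ∀ φ {V W} → SameDom V W → (⟦ φ ⟧ V) ≐ (⟦ φ ⟧ W)
  ⟦⟧-cong φ sd = sd , λ s → mk⇔
    (λ (h , p) → HasDom-cong sd h , p) (λ (h , p) → HasDom-cong (SameDom-sym sd) h , p)

  ⟦∧ⁱ⟧-mem : ∀ φ ψ V s → (mem (⟦ φ ⟧ V) s × mem (⟦ ψ ⟧ V) s) ⇔ mem (⟦ φ ∧ⁱ ψ ⟧ V) s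
  ⟦∧ⁱ⟧-mem φ ψ V s = mk⇔ (λ ((h , p) , (_ , q)) → h , p , q) (λ (h , p , q) → (h , p) , (h , q))

  ⟦∨ⁱ⟧-mem : ∀ φ ψ V s → (mem (⟦ φ ⟧ V) s ⊎ mem (⟦ ψ ⟧ V) s) ⇔ mem (⟦ φ ∨ⁱ ψ ⟧ V) s
  ⟦∨ⁱ⟧-mem φ ψ V s = mk⇔
    (λ { (inj₁ (h , p)) → h , inj₁ p ; (inj₂ (h , q)) → h , inj₂ q })
    (λ { (h , inj₁ p) → inj₁ (h , p) ; (h , inj₂ q) → inj₂ (h , q) })

  ∃T-cong : ∀ x Y Z → Y ≐ Z → ∃T x Y ≐ ∃T x Z
  ∃T-cong x Y Z Y≐Z =
    removeVar-cong (proj₁ Y≐Z) , λ s → mk⇔ (along Y Z Y≐Z) (along Z Y (≐-sym {Y} {Z} Y≐Z))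
    where
    along : ∀ Y Z {s} → Y ≐ Z → mem (∃T x Y) s → mem (∃T x Z) s
    along Y Z (sd , e) (h , inj₁ (a , m)) = HasDom-cong (removeVar-cong sd) h , inj₁ (a , to (e _) m)
    along Y Z (sd , e) (h , inj₂ m)       = HasDom-cong (removeVar-cong sd) h , inj₂ (to (e _) m)

  ∀T-cong : ∀ x Y Z → Y ≐ Z → ∀T x Y ≐ ∀T x Z
  ∀T-cong x Y Z Y≐Z =
    removeVar-cong (proj₁ Y≐Z) , λ s → mk⇔ (along Y Z Y≐Z) (along Z Y (≐-sym {Y} {Z} Y≐Z))
    where
    along : ∀ Y Z {s} → Y ≐ Z → mem (∀T x Y) s → mem (∀T x Z) s
    along Y Z (sd , e) (h , inj₁ f) = HasDom-cong (removeVar-cong sd) h , inj₁ (λ a → to (e _) (f a))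
    along Y Z (sd , e) (h , inj₂ m) = HasDom-cong (removeVar-cong sd) h , inj₂ (to (e _) m)

  ∃T-fresh : ∀ {x} X → x ∉ dom X → ∃T x X ≐ X
  ∃T-fresh {x} X x∉X = removeVar-fresh x∉X , λ s → mk⇔ drop (keep s)
    where
    drop : ∀ {s} → mem (∃T x X) s → mem X s
    drop (_ , inj₁ (a , m)) = ⊥-elim (¬HasDom-update a x∉X (wf X _ m))
    drop (_ , inj₂ m)       = m
    keep : ∀ s → mem X s → mem (∃T x X) s
    keep s m = HasDom-cong (SameDom-sym (removeVar-fresh x∉X)) (wf X s m) , inj₂ m

  ∃T-⟦⟧ : ∀ {x V} φ → x ∉ V → ∃T x (⟦ φ ⟧ (x ∷ V)) ≐ (⟦ ex x φ ⟧ V)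
  ∃T-⟦⟧ {x} {V} φ x∉V = removeVar-∷ x∉V , λ s → mk⇔ project extend
    where
    project : ∀ {s} → mem (∃T x (⟦ φ ⟧ (x ∷ V))) s → mem (⟦ ex x φ ⟧ V) s
    project (h , inj₁ (a , _ , p)) = HasDom-cong (removeVar-∷ x∉V) h , a , p
    project (h , inj₂ (h′ , _))    =
      ⊥-elim (HasDom-defined h′ (here refl) (proj₂ (h x) (∉-removeVar (x ∷ V))))
    extend : ∀ {s} → mem (⟦ ex x φ ⟧ V) s → mem (∃T x (⟦ φ ⟧ (x ∷ V))) s
    extend (h , a , p) =
      let h′ = HasDom-cong (SameDom-sym (removeVar-∷ x∉V)) h
      in h′ , inj₁ (a , HasDom-update a (here refl) h′ , p)

  ∀T-⟦⟧ : ∀ {x V} φ → x ∉ V → ∀T x (⟦ φ ⟧ (x ∷ V)) ≐ (⟦ all x φ ⟧ V)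
  ∀T-⟦⟧ {x} {V} φ x∉V = removeVar-∷ x∉V , λ s → mk⇔ project extend
    where
    project : ∀ {s} → mem (∀T x (⟦ φ ⟧ (x ∷ V))) s → mem (⟦ all x φ ⟧ V) s
    project (h , inj₁ f)        = HasDom-cong (removeVar-∷ x∉V) h , λ a → proj₂ (f a)
    project (h , inj₂ (h′ , _)) =
      ⊥-elim (HasDom-defined h′ (here refl) (proj₂ (h x) (∉-removeVar (x ∷ V))))
    extend : ∀ {s} → mem (⟦ all x φ ⟧ V) s → mem (∀T x (⟦ φ ⟧ (x ∷ V))) s
    extend (h , f) =
      let h′ = HasDom-cong (SameDom-sym (removeVar-∷ x∉V)) h
      in h′ , inj₁ (λ a → HasDom-update a (here refl) h′ , f a)

  Tarskian : Formula → Dom → Set₁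
  Tarskian φ V = ∀ X → SameDom (dom X) V → (X ⊨ φ) ⇔ (X ≐ (⟦ φ ⟧ dom X))

  Tarskian-⊨ : ∀ {φ V} → Tarskian φ V → ∀ Y W →
               SameDom (dom Y) W → SameDom W V → Y ⊨ φ → Y ≐ (⟦ φ ⟧ W)
  Tarskian-⊨ {φ} tφ Y W Y~W W~V Yφ = begin
    Y               ≈⟨ to (tφ Y (SameDom-trans Y~W W~V)) Yφ ⟩
    (⟦ φ ⟧ dom Y)   ≈⟨ ⟦⟧-cong φ Y~W ⟩
    (⟦ φ ⟧ W)       ∎

  Tarskian-⟦⟧ : ∀ {φ V W} → Tarskian φ V → SameDom W V → ⟦ φ ⟧ W ⊨ φ
  Tarskian-⟦⟧ {φ} {W = W} tφ W~V = from (tφ (⟦ φ ⟧ W) W~V) (≐-refl {⟦ φ ⟧ W})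

  tarskian-lit : ∀ l V → Tarskian (lit l) V
  tarskian-lit l V X _ = mk⇔
    (λ (lift sat) → SameDom-refl , λ s →
      mk⇔ (λ m → wf X s m , to (sat s (wf X s m)) m) (λ (h , p) → from (sat s h) p))
    (λ (_ , e) → lift λ s h → mk⇔ (proj₂ ∘ to (e s)) (λ p → from (e s) (h , p)))

  tarskian-∧ⁱ : ∀ {φ ψ V} → Tarskian φ V → Tarskian ψ V → Tarskian (φ ∧ⁱ ψ) V
  tarskian-∧ⁱ {φ} {ψ} tφ tψ X X~V = mk⇔ intersect split
    where
    intersect : X ⊨ φ ∧ⁱ ψ → X ≐ (⟦ φ ∧ⁱ ψ ⟧ dom X)
    intersect (Y , Z , Yφ , Zψ , lift (Y~X , Z~X , e)) = SameDom-refl , λ s →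
      ⇔-trans (e s) (⇔-trans (proj₂ Y≐ s ×-⇔ proj₂ Z≐ s) (⟦∧ⁱ⟧-mem φ ψ (dom X) s))
      where
      Y≐ : Y ≐ (⟦ φ ⟧ dom X)
      Y≐ = Tarskian-⊨ tφ Y (dom X) Y~X X~V Yφ
      Z≐ : Z ≐ (⟦ ψ ⟧ dom X)
      Z≐ = Tarskian-⊨ tψ Z (dom X) Z~X X~V Zψ
    split : X ≐ (⟦ φ ∧ⁱ ψ ⟧ dom X) → X ⊨ φ ∧ⁱ ψ
    split (_ , e) = ⟦ φ ⟧ dom X , ⟦ ψ ⟧ dom X , Tarskian-⟦⟧ tφ X~V , Tarskian-⟦⟧ tψ X~V ,
      lift (SameDom-refl , SameDom-refl , λ s → ⇔-trans (e s) (⇔-sym (⟦∧ⁱ⟧-mem φ ψ (dom X) s)))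

  tarskian-∨ⁱ : ∀ {φ ψ V} → Tarskian φ V → Tarskian ψ V → Tarskian (φ ∨ⁱ ψ) V
  tarskian-∨ⁱ {φ} {ψ} tφ tψ X X~V = mk⇔ unite split
    where
    unite : X ⊨ φ ∨ⁱ ψ → X ≐ (⟦ φ ∨ⁱ ψ ⟧ dom X)
    unite (Y , Z , Yφ , Zψ , lift (Y~X , Z~X , e)) = SameDom-refl , λ s →
      ⇔-trans (e s) (⇔-trans (proj₂ Y≐ s ⊎-⇔ proj₂ Z≐ s) (⟦∨ⁱ⟧-mem φ ψ (dom X) s))
      where
      Y≐ : Y ≐ (⟦ φ ⟧ dom X)
      Y≐ = Tarskian-⊨ tφ Y (dom X) Y~X X~V Yφ
      Z≐ : Z ≐ (⟦ ψ ⟧ dom X)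
      Z≐ = Tarskian-⊨ tψ Z (dom X) Z~X X~V Zψ
    split : X ≐ (⟦ φ ∨ⁱ ψ ⟧ dom X) → X ⊨ φ ∨ⁱ ψ
    split (_ , e) = ⟦ φ ⟧ dom X , ⟦ ψ ⟧ dom X , Tarskian-⟦⟧ tφ X~V , Tarskian-⟦⟧ tψ X~V ,
      lift (SameDom-refl , SameDom-refl , λ s → ⇔-trans (e s) (⇔-sym (⟦∨ⁱ⟧-mem φ ψ (dom X) s)))

  tarskian-ex : ∀ {x φ V} → x ∉ V → Tarskian φ (x ∷ V) → Tarskian (ex x φ) V
  tarskian-ex {x} {φ} x∉V tφ X X~V = mk⇔ project witness
    where
    x∉X : x ∉ dom X
    x∉X = x∉V ∘ to (X~V x)
    project : X ⊨ ex x φ → X ≐ (⟦ ex x φ ⟧ dom X)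
    project (Y , lift (x∈Y , ∃Y≐∃X) , Yφ) = begin
      X                         ≈⟨ ∃T-fresh X x∉X ⟨
      ∃T x X                    ≈⟨ ∃Y≐∃X ⟨
      ∃T x Y                    ≈⟨ ∃T-cong x Y (⟦ φ ⟧ (x ∷ dom X)) Y≐ ⟩
      ∃T x (⟦ φ ⟧ (x ∷ dom X))  ≈⟨ ∃T-⟦⟧ φ x∉X ⟩
      (⟦ ex x φ ⟧ dom X)        ∎
      where
      Y~xX : SameDom (dom Y) (x ∷ dom X)
      Y~xX = SameDom-∷-removeVar x∈Y (SameDom-trans (proj₁ ∃Y≐∃X) (removeVar-fresh x∉X))
      Y≐ : Y ≐ (⟦ φ ⟧ (x ∷ dom X))
      Y≐ = Tarskian-⊨ tφ Y (x ∷ dom X) Y~xX (SameDom-∷ X~V) Yφ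
    witness : X ≐ (⟦ ex x φ ⟧ dom X) → X ⊨ ex x φ
    witness X≐ = ⟦ φ ⟧ (x ∷ dom X) , lift (here refl , ∃Y≐∃X) , Tarskian-⟦⟧ tφ (SameDom-∷ X~V)
      where
      ∃Y≐∃X : ∃T x (⟦ φ ⟧ (x ∷ dom X)) ≐ ∃T x X
      ∃Y≐∃X = begin
        ∃T x (⟦ φ ⟧ (x ∷ dom X))  ≈⟨ ∃T-⟦⟧ φ x∉X ⟩
        (⟦ ex x φ ⟧ dom X)        ≈⟨ X≐ ⟨
        X                         ≈⟨ ∃T-fresh X x∉X ⟨
        ∃T x X                    ∎

  tarskian-all : ∀ {x φ V} → x ∉ V → Tarskian φ (x ∷ V) → Tarskian (all x φ) V
  tarskian-all {x} {φ} x∉V tφ X X~V = mk⇔ project witness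
    where
    x∉X : x ∉ dom X
    x∉X = x∉V ∘ to (X~V x)
    project : X ⊨ all x φ → X ≐ (⟦ all x φ ⟧ dom X)
    project (Y , lift (x∈Y , ∀Y≐∃X) , Yφ) = begin
      X                         ≈⟨ ∃T-fresh X x∉X ⟨
      ∃T x X                    ≈⟨ ∀Y≐∃X ⟨
      ∀T x Y                    ≈⟨ ∀T-cong x Y (⟦ φ ⟧ (x ∷ dom X)) Y≐ ⟩
      ∀T x (⟦ φ ⟧ (x ∷ dom X))  ≈⟨ ∀T-⟦⟧ φ x∉X ⟩
      (⟦ all x φ ⟧ dom X)       ∎
      where
      Y~xX : SameDom (dom Y) (x ∷ dom X)
      Y~xX = SameDom-∷-removeVar x∈Y (SameDom-trans (proj₁ ∀Y≐∃X) (removeVar-fresh x∉X))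
      Y≐ : Y ≐ (⟦ φ ⟧ (x ∷ dom X))
      Y≐ = Tarskian-⊨ tφ Y (x ∷ dom X) Y~xX (SameDom-∷ X~V) Yφ
    witness : X ≐ (⟦ all x φ ⟧ dom X) → X ⊨ all x φ
    witness X≐ = ⟦ φ ⟧ (x ∷ dom X) , lift (here refl , ∀Y≐∃X) , Tarskian-⟦⟧ tφ (SameDom-∷ X~V)
      where
      ∀Y≐∃X : ∀T x (⟦ φ ⟧ (x ∷ dom X)) ≐ ∃T x X
      ∀Y≐∃X = begin
        ∀T x (⟦ φ ⟧ (x ∷ dom X))  ≈⟨ ∀T-⟦⟧ φ x∉X ⟩
        (⟦ all x φ ⟧ dom X)       ≈⟨ X≐ ⟨
        X                         ≈⟨ ∃T-fresh X x∉X ⟨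
        ∃T x X                    ∎

  DisjointBound : Dom → Formula → Set
  DisjointBound V φ = ∀ z → z ∈ V → ¬ Bound z φ

  DisjointBound-∷ : ∀ {x V φ χ} → ¬ Bound x φ → DisjointBound V χ →
                    (∀ {z} → Bound z φ → Bound z χ) → DisjointBound (x ∷ V) φ
  DisjointBound-∷ ¬Bx _  _   _ (here refl)  = ¬Bx
  DisjointBound-∷ _   V# sub z (there z∈V) = V# z z∈V ∘ sub

  tarskian : ∀ φ V → FirstOrder φ → NoRebinding φ → DisjointBound V φ → Tarskian φ V
  tarskian (lit l)   V _          _            _   = tarskian-lit l V
  tarskian (φ ∧ⁱ ψ)  V (foφ , foψ) (nrφ , nrψ) V#  = tarskian-∧ⁱ
    (tarskian φ V foφ nrφ λ z z∈V → V# z z∈V ∘ inj₁) (tarskian ψ V foψ nrψ λ z z∈V → V# z z∈V ∘ inj₂)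
  tarskian (φ ∨ⁱ ψ)  V (foφ , foψ) (nrφ , nrψ) V#  = tarskian-∨ⁱ
    (tarskian φ V foφ nrφ λ z z∈V → V# z z∈V ∘ inj₁) (tarskian ψ V foψ nrψ λ z z∈V → V# z z∈V ∘ inj₂)
  tarskian (ex x φ)  V fo (¬Bx , nr)  V# = tarskian-ex (λ x∈V → V# x x∈V (inj₁ refl))
    (tarskian φ (x ∷ V) fo nr (DisjointBound-∷ {χ = ex x φ} ¬Bx V# inj₂))
  tarskian (all x φ) V fo (¬Bx , nr)  V# = tarskian-all (λ x∈V → V# x x∈V (inj₁ refl))
    (tarskian φ (x ∷ V) fo nr (DisjointBound-∷ {χ = all x φ} ¬Bx V# inj₂))
  tarskian (_ ∧ᵉ _)  V () _ _
  tarskian (_ ∨ᵉ _)  V () _ _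

mainTheorem6 : {L : Signature} (𝓜 : Structure L) →
    let open Syntax L
        open Semantics 𝓜
    in (φ : Formula) (X : Team) →
       FirstOrder φ → Untangled φ →
       (∀ z → Free z φ → z ∈ dom X) →
       (∀ z → z ∈ dom X → ¬ Bound z φ) →
       (X ⊨ φ) ⇔ (X ≐ (⟦ φ ⟧ dom X))
mainTheorem6 𝓜 φ X fo (noRebinding , _) _ X#φ =
  tarskian φ (dom X) fo noRebinding X#φ X SameDom-refl
  where open TarskianTeams 𝓜
        open Semantics 𝓜 using (dom)
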